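{- Let $p \geq 1$, $c = 2p+1$, and let $n \geq 2$ be an integer. Consider a 2-coloring of the edges of a complete graph with vertex set $V$, and let $C$ be a monochromatic cycle on $2p+2$ vertices, say of color $\chi$. Let $u_C \in V \setminus C$ be a vertex maximizing the number of $\chi$-colored edges to $C$, let $S_C$ be the set of vertices of $C$ joined to $u_C$ by a $\chi$-colored edge, let $Z_C = V \setminus C$, and let $T_C^{2p+1}$ be the set of vertices $t \in C$ for which there is $s \in S_C$ such that $t$ and $s$ are the endpoints of a path on $2p+1$ vertices contained in $C$. If some $t \in T_C^{2p+1}$ is joined by $\chi$-colored edges to at least $n+1$ vertices of $Z_C$, then the coloring contains a copy of $S_c(n,2)$ all of whose edges have color $\chi$.
   Context: A path contained in $C$ means a path using consecutive vertices and edges of the cycle $C$; path lengths are counted in vertices. For integers $n \geq m \geq 0$ and $c \geq 1$, the linked double star $S_c(n,m)$ is the graph on vertices $a_1,\dots,a_c, v_1,\dots,v_n, w_1,\dots,w_m$ with edges $a_1v_i$ ($1\le i\le n$), $a_ja_{j+1}$ ($1 \le j \le c-1$) and $a_cw_j$ ($1\le j\le m$). -}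

module Defs where

open import Data.Nat using (ℕ; zero; suc; _+_; _∸_; NonZero)
open import Data.Nat.DivMod using (_mod_)
open import Data.Fin using (Fin; toℕ; zero; suc; fromℕ; inject₁)
open import Data.Bool using (Bool)
open import Data.Bool.Properties using () renaming (_≟_ to _≟ᵇ_)
open import Data.Sum using (_⊎_; inj₁; inj₂)
open import Data.Product using (Σ; ∃; _×_; _,_)
open import Data.List using (length; filter; allFin)
open import Relation.Binary.PropositionalEquality using (_≡_; _≢_)
open import Function.Definitions using (Injective)

-- A 2-colouring of the edges of the complete graph on vertex set Fin N.
-- Colours are Bool; col x y is the colour of the edge xy (only x ≢ y matters).
Coloring : ℕ → Set
Coloring N = Fin N → Fin N → Bool

SymColoring : {N : ℕ} → Coloring N → Set
SymColoring {N} col = (x y : Fin N) → col x y ≡ col y x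

shift : {L : ℕ} → .{{_ : NonZero L}} → Fin L → ℕ → Fin L
shift {L} i k = (toℕ i + k) mod L

MonoCycle : {N L : ℕ} → .{{_ : NonZero L}} → Coloring N → Bool → (Fin L → Fin N) → Set
MonoCycle {N} {L} col χ cyc =
  Injective _≡_ _≡_ cyc × ((i : Fin L) → col (cyc i) (cyc (shift i 1)) ≡ χ)

InCycle : {N L : ℕ} → (Fin L → Fin N) → Fin N → Set
InCycle {N} {L} cyc v = ∃ λ (i : Fin L) → cyc i ≡ v

χdeg : {N L : ℕ} → Coloring N → Bool → (Fin L → Fin N) → Fin N → ℕ
χdeg {N} {L} col χ cyc w = length (filter (λ i → col w (cyc i) ≟ᵇ χ) (allFin L))

PathEnds : {N L : ℕ} → .{{_ : NonZero L}} → (Fin L → Fin N) → ℕ → Fin N → Fin N → Set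
PathEnds {N} {L} cyc k x y = ∃ λ (i : Fin L) →
  (x ≡ cyc i × y ≡ cyc (shift i (k ∸ 1))) ⊎ (y ≡ cyc i × x ≡ cyc (shift i (k ∸ 1)))

-- Linked double star S_{suc k}(n, m): vertices a_1..a_{suc k}, v_1..v_n, w_1..w_m
LDSVertex : ℕ → ℕ → ℕ → Set
LDSVertex k n m = Fin (suc k) ⊎ (Fin n ⊎ Fin m)

data LDSEdge (k n m : ℕ) : LDSVertex k n m → LDSVertex k n m → Set where
  a₁v : (i : Fin n) → LDSEdge k n m (inj₁ zero) (inj₂ (inj₁ i))
  aa  : (j : Fin k) → LDSEdge k n m (inj₁ (inject₁ j)) (inj₁ (suc j))
  a꜀w : (j : Fin m) → LDSEdge k n m (inj₁ (fromℕ k)) (inj₂ (inj₂ j))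

HasMonoLDS : {N : ℕ} → Coloring N → Bool → (k n m : ℕ) → Set
HasMonoLDS {N} col χ k n m = Σ (LDSVertex k n m → Fin N) λ f →
  Injective _≡_ _≡_ f × ((x y : LDSVertex k n m) → LDSEdge k n m x y → col (f x) (f y) ≡ χ)

-- The part of C joining t to s is a χ-path on 2p + 1 vertices. Since C has 2p + 2 vertices,
-- s has two further χ-neighbours off this path: the remaining vertex of C and u. Of the n + 1
-- χ-neighbours of t outside C at most one is u, so n of them can serve as the leaves at t.
module Submission where

open import Defs
open import Data.Nat using (ℕ; suc; _+_; _*_; _∸_; _%_; _≤_; _<_; NonZero)
open import Data.Nat.Properties using (+-comm; +-suc; +-identityʳ; *-zeroʳ; m+n∸n≡m)
open import Data.Nat.DivMod using (_mod_; %-congˡ; %-distribˡ-+; m%n%n≡m%n; m<n⇒m%n≡m; m%n<n; [m+kn]%n≡m%n)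
open import Data.Nat.Tactic.RingSolver using (solve-∀)
open import Data.Fin using (Fin; zero; suc; toℕ; inject₁; fromℕ; punchIn)
open import Data.Fin.Properties using (toℕ-injective; toℕ-fromℕ<; toℕ<n; toℕ-inject₁; toℕ-fromℕ; inject₁-injective; fromℕ≢inject₁; punchIn-injective; punchInᵢ≢i; any?) renaming (_≟_ to _≟ᶠ_)
open import Data.Bool using (Bool)
open import Data.Sum using (inj₁; inj₂; [_,_])
open import Data.Product using (∃; _×_; _,_; proj₁; proj₂)
open import Data.Empty using (⊥-elim)
open import Function.Base using (_∘_)
open import Function.Definitions using (Injective)
open import Relation.Binary.Definitions using (DecidableEquality)
open import Relation.Binary.PropositionalEquality using (_≡_; _≢_; refl; sym; trans; cong; subst; module ≡-Reasoning)
open import Relation.Nullary using (¬_; yes; no)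

[,]-injective : {A B C : Set} {f : A → C} {g : B → C} →
  Injective _≡_ _≡_ f → Injective _≡_ _≡_ g → (∀ a b → f a ≢ g b) →
  Injective _≡_ _≡_ [ f , g ]
[,]-injective f-inj g-inj f≢g {inj₁ a} {inj₁ a′} e = cong inj₁ (f-inj e)
[,]-injective f-inj g-inj f≢g {inj₁ a} {inj₂ b}  e = ⊥-elim (f≢g a b e)
[,]-injective f-inj g-inj f≢g {inj₂ b} {inj₁ a}  e = ⊥-elim (f≢g a b (sym e))
[,]-injective f-inj g-inj f≢g {inj₂ b} {inj₂ b′} e = cong inj₂ (g-inj e)

∃-punchIn-≢ : {A : Set} → DecidableEquality A → {n : ℕ} (g : Fin (suc n) → A) →
  Injective _≡_ _≡_ g → (u : A) → ∃ λ k → ∀ i → g (punchIn k i) ≢ u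
∃-punchIn-≢ _≟_ g g-inj u with any? (λ k → g k ≟ u)
... | yes (k , gk≡u) = k , λ i e → punchInᵢ≢i k i (g-inj (trans e (sym gk≡u)))
... | no ∄k          = zero , λ i e → ∄k (punchIn zero i , e)

%-congˡ-+ : ∀ m n k {L} .{{_ : NonZero L}} → m % L ≡ n % L → (m + k) % L ≡ (n + k) % L
%-congˡ-+ m n k {L} e = begin
  (m + k) % L            ≡⟨ %-distribˡ-+ m k L ⟩
  (m % L + k % L) % L    ≡⟨ cong (λ r → (r + k % L) % L) e ⟩
  (n % L + k % L) % L    ≡⟨ %-distribˡ-+ n k L ⟨
  (n + k) % L            ∎
  where open ≡-Reasoning

+-cancelˡ-% : ∀ x {a b m} → a < suc m → b < suc m →
  (x + a) % suc m ≡ (x + b) % suc m → a ≡ b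
+-cancelˡ-% x {a} {b} {m} a<L b<L e = begin
  a                        ≡⟨ unfold a a<L ⟩
  (x + a + x * m) % suc m  ≡⟨ %-congˡ-+ (x + a) (x + b) (x * m) e ⟩
  (x + b + x * m) % suc m  ≡⟨ unfold b b<L ⟨
  b                        ∎
  where
  open ≡-Reasoning
  shuffle : ∀ c y k → c + y * suc k ≡ y + c + y * k
  shuffle = solve-∀
  unfold : ∀ c → c < suc m → c ≡ (x + c + x * m) % suc m
  unfold c c<L = begin
    c                      ≡⟨ m<n⇒m%n≡m c<L ⟨
    c % suc m              ≡⟨ [m+kn]%n≡m%n c x (suc m) ⟨
    (c + x * suc m) % suc m ≡⟨ %-congˡ (shuffle c x m) ⟩
    (x + c + x * m) % suc m ∎

-- cyc (shift i k) is definitionally cycleAt cyc (toℕ i + k).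
cycleAt : {N L : ℕ} .{{_ : NonZero L}} → (Fin L → Fin N) → ℕ → Fin N
cycleAt {L = L} cyc k = cyc (k mod L)

module _ {N L : ℕ} .{{_ : NonZero L}} (cyc : Fin L → Fin N) where

  cycleAt-cong : ∀ {a b} → a % L ≡ b % L → cycleAt cyc a ≡ cycleAt cyc b
  cycleAt-cong e = cong cyc (toℕ-injective (trans (toℕ-fromℕ< _) (trans e (sym (toℕ-fromℕ< _)))))

  cycleAt-injective : Injective _≡_ _≡_ cyc → ∀ a b → cycleAt cyc a ≡ cycleAt cyc b → a % L ≡ b % L
  cycleAt-injective cyc-inj _ _ e = trans (sym (toℕ-fromℕ< _)) (trans (cong toℕ (cyc-inj e)) (toℕ-fromℕ< _))

  cycleAt-toℕ : ∀ i → cycleAt cyc (toℕ i) ≡ cyc i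
  cycleAt-toℕ i = cong cyc (toℕ-injective (trans (toℕ-fromℕ< _) (m<n⇒m%n≡m (toℕ<n i))))

  cycleAt-periodic : ∀ k q → cycleAt cyc (k + q * L) ≡ cycleAt cyc k
  cycleAt-periodic k q = cycleAt-cong ([m+kn]%n≡m%n k q L)

  cycleAt-∈ : ∀ k → InCycle cyc (cycleAt cyc k)
  cycleAt-∈ k = k mod L , refl

  cycleAt-edge : ∀ {col χ} → MonoCycle col χ cyc → ∀ k → col (cycleAt cyc k) (cycleAt cyc (suc k)) ≡ χ
  cycleAt-edge {col} {χ} (_ , cyc-edge) k =
    subst (λ v → col (cycleAt cyc k) v ≡ χ) (cycleAt-cong next) (cyc-edge (k mod L))
    where
    next : (toℕ (k mod L) + 1) % L ≡ suc k % L
    next = begin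
      (toℕ (k mod L) + 1) % L ≡⟨ %-congˡ (cong (_+ 1) (toℕ-fromℕ< (m%n<n k L))) ⟩
      (k % L + 1) % L         ≡⟨ %-congˡ-+ (k % L) k 1 (m%n%n≡m%n k L) ⟩
      (k + 1) % L             ≡⟨ %-congˡ (+-suc k 0) ⟩
      suc (k + 0) % L         ≡⟨ %-congˡ (cong suc (+-identityʳ k)) ⟩
      suc k % L               ∎
      where open ≡-Reasoning

IsMonoPath : {N m : ℕ} → Coloring N → Bool → (Fin (suc m) → Fin N) → Set
IsMonoPath col χ h = Injective _≡_ _≡_ h × (∀ k → col (h (inject₁ k)) (h (suc k)) ≡ χ)

isMonoPath-toℕ : ∀ {N m} (col : Coloring N) (χ : Bool) (w : ℕ → Fin N) →
  (∀ {a b} → a < suc m → b < suc m → w a ≡ w b → a ≡ b) →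
  (∀ k → col (w k) (w (suc k)) ≡ χ) →
  IsMonoPath col χ (λ (k : Fin (suc m)) → w (toℕ k))
isMonoPath-toℕ col χ w w-inj w-edge =
  (λ {a} {b} e → toℕ-injective (w-inj (toℕ<n a) (toℕ<n b) e)) ,
  λ k → subst (λ r → col (w r) (w (suc (toℕ k))) ≡ χ) (sym (toℕ-inject₁ k)) (w-edge (toℕ k))

module _ {N K : ℕ} {col : Coloring N} {χ : Bool} {cyc : Fin (suc (suc K)) → Fin N}
         (mc : MonoCycle col χ cyc) where

  forwardPath : ∀ i → IsMonoPath col χ (λ (k : Fin (suc (suc K))) → cycleAt cyc (i + toℕ k))
  forwardPath i = isMonoPath-toℕ col χ (λ k → cycleAt cyc (i + k))
    (λ a<L b<L e → +-cancelˡ-% i a<L b<L (cycleAt-injective cyc (proj₁ mc) (i + _) (i + _) e))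
    (λ k → subst (λ r → col (cycleAt cyc (i + k)) (cycleAt cyc r) ≡ χ) (sym (+-suc i k))
             (cycleAt-edge cyc {col} {χ} mc (i + k)))

  -- Stepping by suc K ≡ -1 (mod suc (suc K)) walks the cycle backwards.
  backwardPath : SymColoring col → ∀ j → IsMonoPath col χ (λ (k : Fin (suc (suc K))) → cycleAt cyc (j + suc K * toℕ k))
  backwardPath col-sym j = isMonoPath-toℕ col χ w w-inj w-edge
    where
    L = suc (suc K)
    w : ℕ → Fin N
    w k = cycleAt cyc (j + suc K * k)

    w-inj : ∀ {a b} → a < L → b < L → w a ≡ w b → a ≡ b
    w-inj {a} {b} a<L b<L e = sym (+-cancelˡ-% j b<L a<L (begin
      (j + b) % L                    ≡⟨ [m+kn]%n≡m%n (j + b) a L ⟨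
      (j + b + a * L) % L            ≡⟨ %-congˡ (rearrange j K a b) ⟨
      (j + suc K * a + (a + b)) % L  ≡⟨ %-congˡ-+ (j + suc K * a) (j + suc K * b) (a + b) wa≡wb ⟩
      (j + suc K * b + (a + b)) % L  ≡⟨ %-congˡ (cong (j + suc K * b +_) (+-comm a b)) ⟩
      (j + suc K * b + (b + a)) % L  ≡⟨ %-congˡ (rearrange j K b a) ⟩
      (j + a + b * L) % L            ≡⟨ [m+kn]%n≡m%n (j + a) b L ⟩
      (j + a) % L                    ∎))
      where
      open ≡-Reasoning
      wa≡wb : (j + suc K * a) % L ≡ (j + suc K * b) % L
      wa≡wb = cycleAt-injective cyc (proj₁ mc) (j + suc K * a) (j + suc K * b) e
      rearrange : ∀ x m c d → x + suc m * c + (c + d) ≡ x + d + c * suc (suc m)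
      rearrange = solve-∀

    w-edge : ∀ k → col (w k) (w (suc k)) ≡ χ
    w-edge k = trans (col-sym _ _)
      (subst (λ v → col (w (suc k)) v ≡ χ) back (cycleAt-edge cyc {col} {χ} mc (j + suc K * suc k)))
      where
      one-step-back : ∀ x m k → suc (x + suc m * suc k) ≡ x + suc m * k + 1 * suc (suc m)
      one-step-back = solve-∀
      back : cycleAt cyc (suc (j + suc K * suc k)) ≡ w k
      back = trans (cong (cycleAt cyc) (one-step-back j K k)) (cycleAt-periodic cyc (j + suc K * k) 1)

  spanningPath : SymColoring col → ∀ {t s} → PathEnds cyc (K + 1) t s →
    ∃ λ (h : Fin (suc (suc K)) → Fin N) → IsMonoPath col χ h × (∀ k → InCycle cyc (h k)) ×
      h zero ≡ t × h (inject₁ (fromℕ K)) ≡ s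
  spanningPath _ (i , inj₁ (t≡ , s≡)) =
    (λ k → cycleAt cyc (toℕ i + toℕ k)) , forwardPath (toℕ i) ,
    (λ k → cycleAt-∈ cyc (toℕ i + toℕ k)) , first , last
    where
    first : cycleAt cyc (toℕ i + 0) ≡ _
    first = trans (cong (cycleAt cyc) (+-identityʳ (toℕ i))) (trans (cycleAt-toℕ cyc i) (sym t≡))
    last : cycleAt cyc (toℕ i + toℕ (inject₁ (fromℕ K))) ≡ _
    last = trans (cong (λ r → cycleAt cyc (toℕ i + r)) toℕ-last) (sym s≡)
      where
      toℕ-last : toℕ (inject₁ (fromℕ K)) ≡ K + 1 ∸ 1
      toℕ-last = trans (toℕ-inject₁ (fromℕ K)) (trans (toℕ-fromℕ K) (sym (m+n∸n≡m K 1)))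
  spanningPath col-sym (i , inj₂ (s≡ , t≡)) =
    (λ k → cycleAt cyc (toℕ i + K + suc K * toℕ k)) , backwardPath col-sym (toℕ i + K) ,
    (λ k → cycleAt-∈ cyc (toℕ i + K + suc K * toℕ k)) , first , last
    where
    open ≡-Reasoning
    first : cycleAt cyc (toℕ i + K + suc K * 0) ≡ _
    first = begin
      cycleAt cyc (toℕ i + K + suc K * 0) ≡⟨ cong (λ r → cycleAt cyc (toℕ i + K + r)) (*-zeroʳ (suc K)) ⟩
      cycleAt cyc (toℕ i + K + 0)         ≡⟨ cong (cycleAt cyc) (+-identityʳ (toℕ i + K)) ⟩
      cycleAt cyc (toℕ i + K)             ≡⟨ cong (λ r → cycleAt cyc (toℕ i + r)) (m+n∸n≡m K 1) ⟨
      cycleAt cyc (toℕ i + (K + 1 ∸ 1))   ≡⟨ t≡ ⟨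
      _                                   ∎
    last : cycleAt cyc (toℕ i + K + suc K * toℕ (inject₁ (fromℕ K))) ≡ _
    last = begin
      cycleAt cyc (toℕ i + K + suc K * toℕ (inject₁ (fromℕ K)))
        ≡⟨ cong (λ r → cycleAt cyc (toℕ i + K + suc K * r)) (trans (toℕ-inject₁ (fromℕ K)) (toℕ-fromℕ K)) ⟩
      cycleAt cyc (toℕ i + K + suc K * K)   ≡⟨ cong (cycleAt cyc) (around (toℕ i) K) ⟩
      cycleAt cyc (toℕ i + K * suc (suc K)) ≡⟨ cycleAt-periodic cyc (toℕ i) K ⟩
      cycleAt cyc (toℕ i)                   ≡⟨ cycleAt-toℕ cyc i ⟩
      cyc i                                 ≡⟨ s≡ ⟨
      _                                     ∎
      where
      around : ∀ x m → x + m + suc m * m ≡ x + m * suc (suc m)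
      around = solve-∀

monoLDS-from-path : ∀ {N K n} (col : Coloring N) (χ : Bool) (X : Fin N → Set)
  {h : Fin (suc (suc K)) → Fin N} → IsMonoPath col χ h → (∀ k → X (h k)) →
  {u : Fin N} → ¬ X u → col (h (inject₁ (fromℕ K))) u ≡ χ →
  {g : Fin (suc n) → Fin N} → Injective _≡_ _≡_ g → (∀ k → ¬ X (g k)) → (∀ k → col (h zero) (g k) ≡ χ) →
  HasMonoLDS col χ K n 2
monoLDS-from-path {K = K} col χ X {h} (h-inj , h-edge) h∈X {u} u∉X hₖu {g} g-inj g∉X h₀g
  with ∃-punchIn-≢ _≟ᶠ_ g g-inj u
... | k₀ , v≢u = [ h ∘ inject₁ , [ v , w ] ] , f-inj , f-edge
  where
  v : _ → Fin _
  v = g ∘ punchIn k₀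

  w : Fin 2 → Fin _
  w zero       = h (fromℕ (suc K))
  w (suc zero) = u

  X-separates : ∀ {x y} → X x → ¬ X y → x ≢ y
  X-separates x∈X y∉X x≡y = y∉X (subst X x≡y x∈X)

  w-inj : Injective _≡_ _≡_ w
  w-inj {zero}     {zero}     _ = refl
  w-inj {zero}     {suc zero} e = ⊥-elim (X-separates (h∈X _) u∉X e)
  w-inj {suc zero} {zero}     e = ⊥-elim (X-separates (h∈X _) u∉X (sym e))
  w-inj {suc zero} {suc zero} _ = refl

  v≢w : ∀ i j → v i ≢ w j
  v≢w i zero       e = X-separates (h∈X _) (g∉X _) (sym e)
  v≢w i (suc zero) e = v≢u i e

  path≢leaf : ∀ a x → h (inject₁ a) ≢ [ v , w ] x
  path≢leaf a (inj₁ i)          = X-separates (h∈X _) (g∉X _)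
  path≢leaf a (inj₂ zero)       = fromℕ≢inject₁ ∘ sym ∘ h-inj
  path≢leaf a (inj₂ (suc zero)) = X-separates (h∈X _) u∉X

  f-inj : Injective _≡_ _≡_ [ h ∘ inject₁ , [ v , w ] ]
  f-inj = [,]-injective (inject₁-injective ∘ h-inj)
            ([,]-injective (punchIn-injective k₀ _ _ ∘ g-inj) w-inj v≢w) path≢leaf

  f-edge : ∀ x y → LDSEdge K _ 2 x y → col ([ h ∘ inject₁ , [ v , w ] ] x) ([ h ∘ inject₁ , [ v , w ] ] y) ≡ χ
  f-edge _ _ (a₁v i)          = h₀g (punchIn k₀ i)
  f-edge _ _ (aa j)           = h-edge (inject₁ j)
  f-edge _ _ (a꜀w zero)       = h-edge (fromℕ K)
  f-edge _ _ (a꜀w (suc zero)) = hₖu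

lemma3p21 : (p n N : ℕ) → 1 ≤ p → 2 ≤ n →
    (col : Coloring N) → SymColoring col → (χ : Bool) →
    (cyc : Fin (suc (suc (2 * p))) → Fin N) → MonoCycle col χ cyc →
    (u : Fin N) → ¬ InCycle cyc u →
    ((w : Fin N) → ¬ InCycle cyc w → χdeg col χ cyc w ≤ χdeg col χ cyc u) →
    (t : Fin N) → InCycle cyc t →
    (∃ λ (s : Fin N) → InCycle cyc s × col u s ≡ χ × PathEnds cyc (2 * p + 1) t s) →
    (∃ λ (g : Fin (suc n) → Fin N) → Injective _≡_ _≡_ g ×
    ((k : Fin (suc n)) → ¬ InCycle cyc (g k) × col t (g k) ≡ χ)) →
    HasMonoLDS col χ (2 * p) n 2
lemma3p21 p n N _ _ col col-sym χ cyc mc u u∉C _ t _ (s , _ , us , t⋯s) (g , g-inj , g-prop)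
  with spanningPath mc col-sym t⋯s
... | h , path , h∈C , h₀≡t , hₖ≡s =
  monoLDS-from-path col χ (InCycle cyc) path h∈C u∉C
    (trans (cong (λ x → col x u) hₖ≡s) (trans (col-sym s u) us))
    g-inj (proj₁ ∘ g-prop)
    (λ k → trans (cong (λ x → col x (g k)) h₀≡t) (proj₂ (g-prop k)))
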